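{- Let $D^-$ be the additive code defined in the context and $\Gamma_{D^- }$ its coset graph. Then $\Gamma_{D^- }$ is a distance-regular graph with intersection array $\{33,30,15;1,2,15\}$, i.e. $b_0=33,b_1=30,b_2=15$ and $c_1=1,c_2=2,c_3=15$, where for vertices $u,v$ at distance $i$, $b_i$ is the number of neighbours of $v$ at distance $i+1$ from $u$ and $c_i$ the number of neighbours of $v$ at distance $i-1$ from $u$.
   Context: $\mathbb{F}_4=\{0,1,\omega,\omega^2\}$ with $\omega^2=\omega+1$. An additive code of length $n$ over $\mathbb{F}_4$ is an additive subgroup of $\mathbb{F}_4^n$. The coset graph $\Gamma_C$ of an additive code $C\subseteq\mathbb{F}_4^n$ has as vertices the cosets $x+C$, $x\in\mathbb{F}_4^n$, two cosets being adjacent if their difference contains a vector of Hamming weight $1$. $D^-$ is the $\mathbb{F}_2$-span of the following $12$ vectors of $\mathbb{F}_4^{11}$: $(0,0,0,0,0,\omega^2,\omega^2,0,\omega,1,\omega)$, $(0,0,0,0,0,\omega,0,\omega,\omega,\omega,1)$, $(1,0,0,0,0,1,0,1,\omega^2,\omega^2,1)$, $(\omega,0,0,0,0,0,\omega,1,\omega,\omega,\omega)$, $(0,1,0,0,0,0,1,1,1,\omega^2,\omega^2)$, $(0,\omega,0,0,0,\omega^2,1,\omega^2,\omega,\omega,0)$, $(0,0,1,0,0,\omega,\omega,1,1,0,1)$, $(0,0,\omega,0,0,\omega,1,\omega,\omega^2,\omega^2,0)$, $(0,0,0,1,0,\omega,\omega,\omega,0,1,\omega)$, $(0,0,0,\omega,0,\omega^2,1,1,\omega^2,0,\omega)$,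 $(0,0,0,0,1,\omega^2,\omega^2,\omega^2,1,0,\omega^2)$, $(0,0,0,0,\omega,\omega,1,0,1,\omega,\omega)$. (It is equivalent to the dodecacode punctured in one coordinate; it has $4^6$ codewords, so $\Gamma_{D^- }$ has $4^5=2^{10}$ vertices.) -}

module Defs where

open import Data.Nat using (ℕ; zero; suc; _<_; _≤_)
open import Data.Bool using (Bool; true; false)
open import Data.Fin using (Fin; toℕ)
open import Data.Vec using (Vec; []; _∷_; zipWith; replicate; foldr; lookup)
open import Data.List using (List; length)
open import Data.List.Relation.Unary.All using (All)
open import Data.List.Relation.Unary.Any using (Any)
open import Data.List.Relation.Unary.AllPairs using (AllPairs)
open import Data.Product using (Σ; _×_)
open import Relation.Binary.PropositionalEquality using (_≡_)
open import Relation.Nullary using (¬_)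

data F4 : Set where
  𝟎 𝟏 ω ω² : F4

infixl 6 _+F_
_+F_ : F4 → F4 → F4
𝟎  +F y  = y
x  +F 𝟎  = x
𝟏  +F 𝟏  = 𝟎
𝟏  +F ω  = ω²
𝟏  +F ω² = ω
ω  +F 𝟏  = ω²
ω  +F ω  = 𝟎
ω  +F ω² = 𝟏
ω² +F 𝟏  = ω
ω² +F ω  = 𝟏
ω² +F ω² = 𝟎

n : ℕ
n = 11

Word : Set
Word = Vec F4 n

infixl 6 _⊕_
_⊕_ : Word → Word → Word
_⊕_ = zipWith _+F_

zeroW : Word
zeroW = replicate n 𝟎

wt : ∀ {m} → Vec F4 m → ℕ
wt [] = 0
wt (𝟎 ∷ xs) = wt xs
wt (_ ∷ xs) = suc (wt xs)

-- The additive code D⁻: the F2-span of 12 generators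

gens : Vec Word 12
gens =
    (𝟎 ∷ 𝟎 ∷ 𝟎 ∷ 𝟎 ∷ 𝟎 ∷ ω² ∷ ω² ∷ 𝟎 ∷ ω ∷ 𝟏 ∷ ω ∷ [])
  ∷ (𝟎 ∷ 𝟎 ∷ 𝟎 ∷ 𝟎 ∷ 𝟎 ∷ ω ∷ 𝟎 ∷ ω ∷ ω ∷ ω ∷ 𝟏 ∷ [])
  ∷ (𝟏 ∷ 𝟎 ∷ 𝟎 ∷ 𝟎 ∷ 𝟎 ∷ 𝟏 ∷ 𝟎 ∷ 𝟏 ∷ ω² ∷ ω² ∷ 𝟏 ∷ [])
  ∷ (ω ∷ 𝟎 ∷ 𝟎 ∷ 𝟎 ∷ 𝟎 ∷ 𝟎 ∷ ω ∷ 𝟏 ∷ ω ∷ ω ∷ ω ∷ [])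
  ∷ (𝟎 ∷ 𝟏 ∷ 𝟎 ∷ 𝟎 ∷ 𝟎 ∷ 𝟎 ∷ 𝟏 ∷ 𝟏 ∷ 𝟏 ∷ ω² ∷ ω² ∷ [])
  ∷ (𝟎 ∷ ω ∷ 𝟎 ∷ 𝟎 ∷ 𝟎 ∷ ω² ∷ 𝟏 ∷ ω² ∷ ω ∷ ω ∷ 𝟎 ∷ [])
  ∷ (𝟎 ∷ 𝟎 ∷ 𝟏 ∷ 𝟎 ∷ 𝟎 ∷ ω ∷ ω ∷ 𝟏 ∷ 𝟏 ∷ 𝟎 ∷ 𝟏 ∷ [])
  ∷ (𝟎 ∷ 𝟎 ∷ ω ∷ 𝟎 ∷ 𝟎 ∷ ω ∷ 𝟏 ∷ ω ∷ ω² ∷ ω² ∷ 𝟎 ∷ [])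
  ∷ (𝟎 ∷ 𝟎 ∷ 𝟎 ∷ 𝟏 ∷ 𝟎 ∷ ω ∷ ω ∷ ω ∷ 𝟎 ∷ 𝟏 ∷ ω ∷ [])
  ∷ (𝟎 ∷ 𝟎 ∷ 𝟎 ∷ ω ∷ 𝟎 ∷ ω² ∷ 𝟏 ∷ 𝟏 ∷ ω² ∷ 𝟎 ∷ ω ∷ [])
  ∷ (𝟎 ∷ 𝟎 ∷ 𝟎 ∷ 𝟎 ∷ 𝟏 ∷ ω² ∷ ω² ∷ ω² ∷ 𝟏 ∷ 𝟎 ∷ ω² ∷ [])
  ∷ (𝟎 ∷ 𝟎 ∷ 𝟎 ∷ 𝟎 ∷ ω ∷ ω ∷ 𝟏 ∷ 𝟎 ∷ 𝟏 ∷ ω ∷ ω ∷ [])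
  ∷ []

combo : ∀ {k} → Vec Bool k → Vec Word k → Word
combo [] [] = zeroW
combo (false ∷ cs) (_ ∷ gs) = combo cs gs
combo (true ∷ cs) (g ∷ gs) = g ⊕ combo cs gs

InD : Word → Set
InD x = Σ (Vec Bool 12) (λ cs → combo cs gens ≡ x)

-- The coset graph Γ_{D⁻}.  A vertex x + D⁻ is represented by any x;
-- "x and y represent the same vertex" is SameCoset x y.
-- Since char F4 = 2, x - y = x ⊕ y.

SameCoset : Word → Word → Set
SameCoset x y = InD (x ⊕ y)

-- x + C and y + C adjacent iff (x + C) - (y + C) = x - y + C contains
-- a word of Hamming weight 1.
Adj : Word → Word → Set
Adj x y = Σ Word (λ e → wt e ≡ 1 × InD (x ⊕ y ⊕ e))

Walk : ℕ → Word → Word → Set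
Walk zero u v = SameCoset u v
Walk (suc k) u v = Σ Word (λ w → Adj u w × Walk k w v)

Dist : Word → Word → ℕ → Set
Dist u v i = Walk i u v × (∀ j → j < i → ¬ Walk j u v)

CosetCount : (Word → Set) → ℕ → Set
CosetCount P k =
  Σ (List Word) (λ ws →
      length ws ≡ k
    × All P ws
    × AllPairs (λ a b → ¬ SameCoset a b) ws
    × (∀ w → P w → Any (SameCoset w) ws))

-- Γ_{D⁻} is distance-regular with intersection array
-- {b₀,…,b_{d-1}; c₁,…,c_d}: it has diameter ≤ d (every pair of vertices
-- is joined by a walk of length ≤ d, i.e. at distance ≤ d), and for all
-- vertices u, v with d(u,v) = i, the number of neighbours w of v with
-- d(u,w) = i+1 is b_i (0 ≤ i < d) and with d(u,w) = i-1 is c_i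
-- (1 ≤ i ≤ d).  (bs[i] = b_i, cs[i] = c_{i+1}.)
IsDRGWithArray : (d : ℕ) → Vec ℕ d → Vec ℕ d → Set
IsDRGWithArray d bs cs =
    (∀ u v → Σ ℕ (λ j → j ≤ d × Walk j u v))
  × (∀ (i : Fin d) u v → Dist u v (toℕ i) →
       CosetCount (λ w → Adj v w × Dist u w (suc (toℕ i))) (lookup bs i))
  × (∀ (i : Fin d) u v → Dist u v (suc (toℕ i)) →
       CosetCount (λ w → Adj v w × Dist u w (toℕ i)) (lookup cs i))

{-# OPTIONS --safe #-}
module Submission where

-- The syndrome map σ : F₄¹¹ → F₄⁵ of D⁻ is F₂-linear with kernel exactly D⁻, so cosets
-- are syndromes and Γ_{D⁻} is the Cayley graph of (F₄⁵, +) with connection set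
-- {σ e | wt e = 1}; the distance from u to v is a function of σ u + σ v alone.  That
-- function is given as a table of 4⁵ values and certified by evaluation: it vanishes
-- at 0, changes by at most one along an edge, and decreases along some edge from every
-- nonzero syndrome.  The intersection numbers are then counts of neighbours at each
-- distance, again checked for all 1024 syndromes.

open import Defs
open import Data.Bool using (Bool; true; false; _xor_)
open import Data.Bool.Properties using (xor-assoc; xor-comm; xor-same)
open import Data.Empty using (⊥-elim)
open import Data.Fin using (Fin; toℕ; #_) renaming (zero to fzero; suc to fsuc)
import Data.Fin.Properties as Fin
open import Data.Fin.Subset using (Subset; ⁅_⁆; _∪_) renaming (⊥ to ∅)
open import Data.List using (List; []; _∷_; length; map; filter)
open import Data.List.Properties using (length-map)
open import Data.List.Membership.Propositional using (_∈_; find; lose)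
open import Data.List.Membership.Propositional.Properties using (∈-map⁺; ∈-map⁻; ∈-filter⁺; ∈-filter⁻)
open import Data.List.Relation.Unary.All as All using (All)
open import Data.List.Relation.Unary.All.Properties using (map⁺)
open import Data.List.Relation.Unary.Any using (Any; here; there; any?)
open import Data.List.Relation.Unary.AllPairs as AllPairs using (AllPairs; allPairs?)
import Data.List.Relation.Unary.AllPairs.Properties as AllPairsₚ
open import Data.Nat using (ℕ; zero; suc; pred; _≤_; s≤s; _≤?_)
open import Data.Nat.Properties using (≤-reflexive; m≤n⇒m<n∨m≡n; <⇒≱; suc-injective; 0≢1+n; 1+n≢0; module ≤-Reasoning) renaming (_≟_ to _≟ℕ_)
open import Data.Product using (Σ; _×_; _,_; proj₁; proj₂)
open import Data.Sum using (_⊎_; inj₁; inj₂)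
open import Data.Vec using (Vec; []; _∷_; zipWith; replicate; lookup; _++_)
import Data.Vec.Properties as Vec
import Data.Vec.Relation.Unary.All as VecAll
open import Relation.Binary.Definitions using (DecidableEquality)
open import Relation.Binary.PropositionalEquality
open import Relation.Nullary using (¬_; Dec; does; ¬?)
open import Relation.Nullary.Decidable using (map′; from-yes; _×-dec_; _⊎-dec_; _→-dec_)
open import Relation.Unary using (Decidable)
open import Function using (_∘_)

index : F4 → Fin 4
index 𝟎  = # 0
index 𝟏  = # 1
index ω  = # 2
index ω² = # 3

fromIndex : Fin 4 → F4
fromIndex = lookup (𝟎 ∷ 𝟏 ∷ ω ∷ ω² ∷ [])

fromIndex-index : ∀ a → fromIndex (index a) ≡ a
fromIndex-index 𝟎  = refl
fromIndex-index 𝟏  = refl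
fromIndex-index ω  = refl
fromIndex-index ω² = refl

index-injective : ∀ {a b} → index a ≡ index b → a ≡ b
index-injective {a} {b} p = begin
  a                   ≡⟨ sym (fromIndex-index a) ⟩
  fromIndex (index a) ≡⟨ cong fromIndex p ⟩
  fromIndex (index b) ≡⟨ fromIndex-index b ⟩
  b                   ∎
  where open ≡-Reasoning

infix 4 _≟F_
_≟F_ : DecidableEquality F4
a ≟F b = map′ index-injective (cong index) (index a Fin.≟ index b)

∀F4? : {P : F4 → Set} → Decidable P → Dec (∀ a → P a)
∀F4? P? = map′ (λ { (p𝟎 , p𝟏 , pω , pω²) → λ { 𝟎 → p𝟎 ; 𝟏 → p𝟏 ; ω → pω ; ω² → pω² } })
               (λ p → p 𝟎 , p 𝟏 , p ω , p ω²)
               (P? 𝟎 ×-dec P? 𝟏 ×-dec P? ω ×-dec P? ω²)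

∀F4ⁿ? : ∀ m {P : Vec F4 m → Set} → Decidable P → Dec (∀ v → P v)
∀F4ⁿ? zero    P? = map′ (λ p → λ { [] → p }) (λ p → p []) (P? [])
∀F4ⁿ? (suc m) P? = map′ (λ p → λ { (a ∷ v) → p a v }) (λ p a v → p (a ∷ v))
                        (∀F4? λ a → ∀F4ⁿ? m λ v → P? (a ∷ v))

+F-assoc : ∀ a b c → (a +F b) +F c ≡ a +F (b +F c)
+F-assoc = from-yes (∀F4? λ a → ∀F4? λ b → ∀F4? λ c → (a +F b) +F c ≟F a +F (b +F c))

+F-comm : ∀ a b → a +F b ≡ b +F a
+F-comm = from-yes (∀F4? λ a → ∀F4? λ b → a +F b ≟F b +F a)

+F-self : ∀ a → a +F a ≡ 𝟎
+F-self = from-yes (∀F4? λ a → a +F a ≟F 𝟎)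

record BooleanGroup : Set₁ where
  infixl 6 _∙_
  field
    Carrier      : Set
    _∙_          : Carrier → Carrier → Carrier
    ε            : Carrier
    assoc        : ∀ x y z → (x ∙ y) ∙ z ≡ x ∙ (y ∙ z)
    comm         : ∀ x y → x ∙ y ≡ y ∙ x
    identityˡ    : ∀ x → ε ∙ x ≡ x
    self-inverse : ∀ x → x ∙ x ≡ ε

  identityʳ : ∀ x → x ∙ ε ≡ x
  identityʳ x = trans (comm x ε) (identityˡ x)

  cancelˡ : ∀ x y → x ∙ (x ∙ y) ≡ y
  cancelˡ x y = begin
    x ∙ (x ∙ y) ≡⟨ sym (assoc x x y) ⟩
    x ∙ x ∙ y   ≡⟨ cong (_∙ y) (self-inverse x) ⟩
    ε ∙ y       ≡⟨ identityˡ y ⟩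
    y           ∎
    where open ≡-Reasoning

  ∙-cancelˡ : ∀ x {y z} → x ∙ y ≡ x ∙ z → y ≡ z
  ∙-cancelˡ x {y} {z} p = trans (sym (cancelˡ x y)) (trans (cong (x ∙_) p) (cancelˡ x z))

  ∙≡ε⇒≡ : ∀ {x y} → x ∙ y ≡ ε → x ≡ y
  ∙≡ε⇒≡ {x} {y} p = ∙-cancelˡ y (trans (comm y x) (trans p (sym (self-inverse y))))

  x∙yz≡y∙xz : ∀ x y z → x ∙ (y ∙ z) ≡ y ∙ (x ∙ z)
  x∙yz≡y∙xz x y z = trans (sym (assoc x y z)) (trans (cong (_∙ z) (comm x y)) (assoc y x z))

  x≡y∙z⇒y≡x∙z : ∀ {x y z} → x ≡ y ∙ z → y ≡ x ∙ z
  x≡y∙z⇒y≡x∙z {x} {y} {z} p = sym (begin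
    x ∙ z       ≡⟨ cong (_∙ z) p ⟩
    y ∙ z ∙ z   ≡⟨ assoc y z z ⟩
    y ∙ (z ∙ z) ≡⟨ cong (y ∙_) (self-inverse z) ⟩
    y ∙ ε       ≡⟨ identityʳ y ⟩
    y           ∎)
    where open ≡-Reasoning

  xy∙z≡xz∙y : ∀ x y z → x ∙ y ∙ z ≡ x ∙ z ∙ y
  xy∙z≡xz∙y x y z = trans (assoc x y z) (trans (cong (x ∙_) (comm y z)) (sym (assoc x z y)))

  interchange : ∀ w x y z → (w ∙ x) ∙ (y ∙ z) ≡ (w ∙ y) ∙ (x ∙ z)
  interchange w x y z = begin
    (w ∙ x) ∙ (y ∙ z) ≡⟨ assoc w x (y ∙ z) ⟩
    w ∙ (x ∙ (y ∙ z)) ≡⟨ cong (w ∙_) (x∙yz≡y∙xz x y z) ⟩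
    w ∙ (y ∙ (x ∙ z)) ≡⟨ sym (assoc w y (x ∙ z)) ⟩
    (w ∙ y) ∙ (x ∙ z) ∎
    where open ≡-Reasoning

F4-booleanGroup : BooleanGroup
F4-booleanGroup = record
  { Carrier = F4 ; _∙_ = _+F_ ; ε = 𝟎
  ; assoc = +F-assoc ; comm = +F-comm ; identityˡ = λ _ → refl ; self-inverse = +F-self }

Bool-booleanGroup : BooleanGroup
Bool-booleanGroup = record
  { Carrier = Bool ; _∙_ = _xor_ ; ε = false
  ; assoc = xor-assoc ; comm = xor-comm ; identityˡ = λ _ → refl ; self-inverse = xor-same }

Vec-booleanGroup : BooleanGroup → ℕ → BooleanGroup
Vec-booleanGroup G m = record
  { Carrier = Vec Carrier m ; _∙_ = zipWith _∙_ ; ε = replicate m ε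
  ; assoc = Vec.zipWith-assoc assoc ; comm = Vec.zipWith-comm comm
  ; identityˡ = Vec.zipWith-identityˡ identityˡ ; self-inverse = zipWith-self }
  where
  open BooleanGroup G
  zipWith-self : ∀ {k} (x : Vec Carrier k) → zipWith _∙_ x x ≡ replicate k ε
  zipWith-self []      = refl
  zipWith-self (a ∷ x) = cong₂ _∷_ (self-inverse a) (zipWith-self x)

F4ⁿ : ℕ → BooleanGroup
F4ⁿ = Vec-booleanGroup F4-booleanGroup

length-filter-map : ∀ {A B : Set} {P : B → Set} (P? : Decidable P) (f : A → B) xs →
                    length (filter P? (map f xs)) ≡ length (filter (P? ∘ f) xs)
length-filter-map P? f []       = refl
length-filter-map P? f (x ∷ xs) with does (P? (f x))
... | true  = cong suc (length-filter-map P? f xs)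
... | false = length-filter-map P? f xs

unitVec : ∀ {m} → Fin m → F4 → Vec F4 m
unitVec {suc m} fzero    a = a ∷ replicate m 𝟎
unitVec {suc m} (fsuc i) a = 𝟎 ∷ unitVec i a

module _ (G : BooleanGroup) where
  open BooleanGroup G

  Additive : ∀ {m} → (Vec F4 m → Carrier) → Set
  Additive f = ∀ x y → f (zipWith _+F_ x y) ≡ f x ∙ f y

  additive⇒𝟎↦ε : ∀ {m} {f : Vec F4 m → Carrier} → Additive f → f (replicate m 𝟎) ≡ ε
  additive⇒𝟎↦ε {m} {f} f-add = begin
    f 0s                  ≡⟨ cong f (sym (Vec.zipWith-identityˡ (λ _ → refl) 0s)) ⟩
    f (zipWith _+F_ 0s 0s) ≡⟨ f-add 0s 0s ⟩
    f 0s ∙ f 0s           ≡⟨ self-inverse (f 0s) ⟩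
    ε                     ∎
    where
    open ≡-Reasoning
    0s : Vec F4 m
    0s = replicate m 𝟎

  additive-ext : ∀ {m} {f g : Vec F4 m → Carrier} → Additive f → Additive g →
                 (∀ i a → f (unitVec i a) ≡ g (unitVec i a)) → ∀ z → f z ≡ g z
  additive-ext {zero}  f-add g-add _ [] = trans (additive⇒𝟎↦ε f-add) (sym (additive⇒𝟎↦ε g-add))
  additive-ext {suc m} {f} {g} f-add g-add f≗g (a ∷ z) = begin
    f (a ∷ z)                        ≡⟨ cong f (sym split) ⟩
    f (unitVec fzero a ⊕ₘ (𝟎 ∷ z))   ≡⟨ f-add _ _ ⟩
    f (unitVec fzero a) ∙ f (𝟎 ∷ z)  ≡⟨ cong₂ _∙_ (f≗g fzero a) tails ⟩
    g (unitVec fzero a) ∙ g (𝟎 ∷ z)  ≡⟨ sym (g-add _ _) ⟩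
    g (unitVec fzero a ⊕ₘ (𝟎 ∷ z))   ≡⟨ cong g split ⟩
    g (a ∷ z)                        ∎
    where
    open ≡-Reasoning
    _⊕ₘ_ : Vec F4 (suc m) → Vec F4 (suc m) → Vec F4 (suc m)
    _⊕ₘ_ = zipWith _+F_
    split : unitVec fzero a ⊕ₘ (𝟎 ∷ z) ≡ a ∷ z
    split = cong₂ _∷_ (BooleanGroup.identityʳ F4-booleanGroup a) (Vec.zipWith-identityˡ (λ _ → refl) z)
    tails : f (𝟎 ∷ z) ≡ g (𝟎 ∷ z)
    tails = additive-ext (λ x y → f-add (𝟎 ∷ x) (𝟎 ∷ y)) (λ x y → g-add (𝟎 ∷ x) (𝟎 ∷ y))
                         (λ i b → f≗g (fsuc i) b) z

  column : Carrier × Carrier → F4 → Carrier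
  column (p , q) 𝟎  = ε
  column (p , q) 𝟏  = p
  column (p , q) ω  = q
  column (p , q) ω² = p ∙ q

  column-additive : ∀ pq a b → column pq (a +F b) ≡ column pq a ∙ column pq b
  column-additive pq       𝟎  b  = sym (identityˡ _)
  column-additive pq       𝟏  𝟎  = sym (identityʳ _)
  column-additive pq       ω  𝟎  = sym (identityʳ _)
  column-additive pq       ω² 𝟎  = sym (identityʳ _)
  column-additive (p , q)  𝟏  𝟏  = sym (self-inverse p)
  column-additive (p , q)  𝟏  ω  = refl
  column-additive (p , q)  𝟏  ω² = sym (cancelˡ p q)
  column-additive (p , q)  ω  𝟏  = comm p q
  column-additive (p , q)  ω  ω  = sym (self-inverse q)
  column-additive (p , q)  ω  ω² = sym (trans (cong (q ∙_) (comm p q)) (cancelˡ q p))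
  column-additive (p , q)  ω² 𝟏  = sym (trans (comm (p ∙ q) p) (cancelˡ p q))
  column-additive (p , q)  ω² ω  = sym (trans (assoc p q q) (trans (cong (p ∙_) (self-inverse q)) (identityʳ p)))
  column-additive (p , q)  ω² ω² = sym (self-inverse (p ∙ q))

  fromColumns : ∀ {m} → Vec (Carrier × Carrier) m → Vec F4 m → Carrier
  fromColumns []        []      = ε
  fromColumns (pq ∷ cs) (a ∷ x) = column pq a ∙ fromColumns cs x

  fromColumns-additive : ∀ {m} (cs : Vec (Carrier × Carrier) m) → Additive (fromColumns cs)
  fromColumns-additive []        []      []      = sym (identityˡ ε)
  fromColumns-additive (pq ∷ cs) (a ∷ x) (b ∷ y) =
    trans (cong₂ _∙_ (column-additive pq a b) (fromColumns-additive cs x y)) (interchange _ _ _ _)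

units : ∀ m → List (Vec F4 m)
units zero    = []
units (suc m) = (𝟏 ∷ replicate m 𝟎) ∷ (ω ∷ replicate m 𝟎) ∷ (ω² ∷ replicate m 𝟎) ∷ map (𝟎 ∷_) (units m)

wt-replicate-𝟎 : ∀ m → wt (replicate m 𝟎) ≡ 0
wt-replicate-𝟎 zero    = refl
wt-replicate-𝟎 (suc m) = wt-replicate-𝟎 m

wt≡0⇒≡𝟎 : ∀ {m} (e : Vec F4 m) → wt e ≡ 0 → e ≡ replicate m 𝟎
wt≡0⇒≡𝟎 []       _ = refl
wt≡0⇒≡𝟎 (𝟎 ∷ e) p = cong (𝟎 ∷_) (wt≡0⇒≡𝟎 e p)

wt≡1⇒∈units : ∀ {m} (e : Vec F4 m) → wt e ≡ 1 → e ∈ units m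
wt≡1⇒∈units (𝟎  ∷ e) p = there (there (there (∈-map⁺ (𝟎 ∷_) (wt≡1⇒∈units e p))))
wt≡1⇒∈units (𝟏  ∷ e) p = here (cong (𝟏 ∷_) (wt≡0⇒≡𝟎 e (cong pred p)))
wt≡1⇒∈units (ω  ∷ e) p = there (here (cong (ω ∷_) (wt≡0⇒≡𝟎 e (cong pred p))))
wt≡1⇒∈units (ω² ∷ e) p = there (there (here (cong (ω² ∷_) (wt≡0⇒≡𝟎 e (cong pred p)))))

∈units⇒wt≡1 : ∀ {m} {e : Vec F4 m} → e ∈ units m → wt e ≡ 1
∈units⇒wt≡1 {suc m} (here refl)                 = cong suc (wt-replicate-𝟎 m)
∈units⇒wt≡1 {suc m} (there (here refl))         = cong suc (wt-replicate-𝟎 m)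
∈units⇒wt≡1 {suc m} (there (there (here refl))) = cong suc (wt-replicate-𝟎 m)
∈units⇒wt≡1 {suc m} (there (there (there e∈))) with ∈-map⁻ (𝟎 ∷_) e∈
... | _ , e′∈ , refl = ∈units⇒wt≡1 e′∈

module Words = BooleanGroup (F4ⁿ n)

Syndrome : Set
Syndrome = Vec F4 5

module Syndromes = BooleanGroup (F4ⁿ 5)
open Syndromes using () renaming (_∙_ to _+ₛ_; ε to 0ₛ)

_≟ₛ_ : DecidableEquality Syndrome
_≟ₛ_ = Vec.≡-dec _≟F_

combo-additive : ∀ {k} (cs ds : Subset k) (gs : Vec Word k) →
                 combo (zipWith _xor_ cs ds) gs ≡ combo cs gs ⊕ combo ds gs
combo-additive []           []           []       = refl
combo-additive (false ∷ cs) (false ∷ ds) (g ∷ gs) = combo-additive cs ds gs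
combo-additive (false ∷ cs) (true  ∷ ds) (g ∷ gs) =
  trans (cong (g ⊕_) (combo-additive cs ds gs)) (Words.x∙yz≡y∙xz g _ _)
combo-additive (true  ∷ cs) (false ∷ ds) (g ∷ gs) =
  trans (cong (g ⊕_) (combo-additive cs ds gs)) (sym (Words.assoc g _ _))
combo-additive (true  ∷ cs) (true  ∷ ds) (g ∷ gs) = begin
  combo (zipWith _xor_ cs ds) gs          ≡⟨ combo-additive cs ds gs ⟩
  combo cs gs ⊕ combo ds gs               ≡⟨ sym (Words.identityˡ _) ⟩
  zeroW ⊕ (combo cs gs ⊕ combo ds gs)     ≡⟨ cong (_⊕ _) (sym (Words.self-inverse g)) ⟩
  (g ⊕ g) ⊕ (combo cs gs ⊕ combo ds gs)   ≡⟨ Words.interchange g g _ _ ⟩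
  (g ⊕ combo cs gs) ⊕ (g ⊕ combo ds gs)   ∎
  where open ≡-Reasoning

-- The parity-check matrix [A | I₅] of D⁻; entry j holds its column j as the syndromes
-- of 1·e_j and ω·e_j.
syndromeColumns : Vec (Syndrome × Syndrome) n
syndromeColumns =
    ((ω² ∷ ω² ∷ ω² ∷ 𝟎  ∷ ω  ∷ []) , (ω ∷ 𝟏  ∷ ω  ∷ ω  ∷ ω  ∷ []))
  ∷ ((𝟏  ∷ 𝟏  ∷ 𝟏  ∷ ω² ∷ ω² ∷ []) , (ω ∷ ω² ∷ 𝟎  ∷ ω² ∷ ω  ∷ []))
  ∷ ((ω  ∷ ω² ∷ ω² ∷ ω  ∷ 𝟎  ∷ []) , (𝟏 ∷ 𝟎  ∷ 𝟏  ∷ 𝟏  ∷ 𝟏  ∷ []))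
  ∷ ((ω  ∷ 𝟎  ∷ ω  ∷ ω² ∷ ω² ∷ []) , (ω ∷ 𝟏  ∷ 𝟏  ∷ 𝟏  ∷ 𝟎  ∷ []))
  ∷ ((𝟎  ∷ ω² ∷ ω² ∷ 𝟏  ∷ 𝟏  ∷ []) , (𝟏 ∷ ω  ∷ ω² ∷ 𝟎  ∷ ω² ∷ []))
  ∷ ((ω² ∷ ω  ∷ 𝟎  ∷ ω² ∷ ω² ∷ []) , (𝟎 ∷ ω  ∷ ω  ∷ ω  ∷ 𝟏  ∷ []))
  ∷ ((𝟏  ∷ 𝟎  ∷ 𝟎  ∷ 𝟎  ∷ 𝟎  ∷ []) , (ω ∷ 𝟎  ∷ 𝟎  ∷ 𝟎  ∷ 𝟎  ∷ []))
  ∷ ((𝟎  ∷ 𝟏  ∷ 𝟎  ∷ 𝟎  ∷ 𝟎  ∷ []) , (𝟎 ∷ ω  ∷ 𝟎  ∷ 𝟎  ∷ 𝟎  ∷ []))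
  ∷ ((𝟎  ∷ 𝟎  ∷ 𝟏  ∷ 𝟎  ∷ 𝟎  ∷ []) , (𝟎 ∷ 𝟎  ∷ ω  ∷ 𝟎  ∷ 𝟎  ∷ []))
  ∷ ((𝟎  ∷ 𝟎  ∷ 𝟎  ∷ 𝟏  ∷ 𝟎  ∷ []) , (𝟎 ∷ 𝟎  ∷ 𝟎  ∷ ω  ∷ 𝟎  ∷ []))
  ∷ ((𝟎  ∷ 𝟎  ∷ 𝟎  ∷ 𝟎  ∷ 𝟏  ∷ []) , (𝟎 ∷ 𝟎  ∷ 𝟎  ∷ 𝟎  ∷ ω  ∷ []))
  ∷ []

syndrome : Word → Syndrome
syndrome = fromColumns (F4ⁿ 5) syndromeColumns

syndrome-additive : Additive (F4ⁿ 5) syndrome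
syndrome-additive = fromColumns-additive (F4ⁿ 5) syndromeColumns

-- Coordinates 1–6 form an information set of D⁻: entry j lists the generators summing to
-- the codeword that agrees with 1·e_j (resp. ω·e_j) on them.  So z − codewordPart z
-- vanishes on coordinates 1–6, and [A | I₅] identifies its last five with syndrome z.
coefficientColumns : Vec (Subset 12 × Subset 12) n
coefficientColumns =
    (⁅ # 0 ⁆ ∪ ⁅ # 1 ⁆ ∪ ⁅ # 2 ⁆ , ⁅ # 3 ⁆)
  ∷ (⁅ # 4 ⁆                     , ⁅ # 0 ⁆ ∪ ⁅ # 5 ⁆)
  ∷ (⁅ # 1 ⁆ ∪ ⁅ # 6 ⁆           , ⁅ # 1 ⁆ ∪ ⁅ # 7 ⁆)
  ∷ (⁅ # 1 ⁆ ∪ ⁅ # 8 ⁆           , ⁅ # 0 ⁆ ∪ ⁅ # 9 ⁆)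
  ∷ (⁅ # 0 ⁆ ∪ ⁅ # 10 ⁆          , ⁅ # 1 ⁆ ∪ ⁅ # 11 ⁆)
  ∷ (⁅ # 0 ⁆ ∪ ⁅ # 1 ⁆           , ⁅ # 1 ⁆)
  ∷ (∅ , ∅) ∷ (∅ , ∅) ∷ (∅ , ∅) ∷ (∅ , ∅) ∷ (∅ , ∅)
  ∷ []

Subsets : BooleanGroup
Subsets = Vec-booleanGroup Bool-booleanGroup 12

coefficients : Word → Subset 12
coefficients = fromColumns Subsets coefficientColumns

codewordPart : Word → Word
codewordPart z = combo (coefficients z) gens

codewordPart-additive : Additive (F4ⁿ n) codewordPart
codewordPart-additive x y =
  trans (cong (λ c → combo c gens) (fromColumns-additive Subsets coefficientColumns x y))
        (combo-additive (coefficients x) (coefficients y) gens)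

checkPart : Syndrome → Word
checkPart s = replicate 6 𝟎 ++ s

codewordPlusCheckPart : Word → Word
codewordPlusCheckPart z = codewordPart z ⊕ checkPart (syndrome z)

codewordPlusCheckPart-additive : Additive (F4ⁿ n) codewordPlusCheckPart
codewordPlusCheckPart-additive x y =
  trans (cong₂ _⊕_ (codewordPart-additive x y) (cong checkPart (syndrome-additive x y)))
        (Words.interchange _ _ _ _)

decomposition : ∀ z → z ≡ codewordPlusCheckPart z
decomposition = additive-ext (F4ⁿ n) (λ _ _ → refl) codewordPlusCheckPart-additive
  (from-yes (Fin.all? λ i → ∀F4? λ a →
    Vec.≡-dec _≟F_ (unitVec i a) (codewordPlusCheckPart (unitVec i a))))

gens-syndrome≡0 : VecAll.All (λ g → syndrome g ≡ 0ₛ) gens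
gens-syndrome≡0 = from-yes (VecAll.all? (λ g → syndrome g ≟ₛ 0ₛ) gens)

syndrome-combo : ∀ {k} (cs : Subset k) {gs : Vec Word k} → VecAll.All (λ g → syndrome g ≡ 0ₛ) gs →
                 syndrome (combo cs gs) ≡ 0ₛ
syndrome-combo []           VecAll.[]          = refl
syndrome-combo (false ∷ cs) (_ VecAll.∷ gs≡0)  = syndrome-combo cs gs≡0
syndrome-combo (true ∷ cs) {g ∷ gs} (g≡0 VecAll.∷ gs≡0) =
  trans (syndrome-additive g (combo cs gs)) (cong₂ _+ₛ_ g≡0 (syndrome-combo cs gs≡0))

InD⇒syndrome≡0 : ∀ {z} → InD z → syndrome z ≡ 0ₛ
InD⇒syndrome≡0 (cs , refl) = syndrome-combo cs gens-syndrome≡0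

syndrome≡0⇒InD : ∀ {z} → syndrome z ≡ 0ₛ → InD z
syndrome≡0⇒InD {z} s≡0 = coefficients z , sym (begin
  z                                          ≡⟨ decomposition z ⟩
  codewordPart z ⊕ checkPart (syndrome z)    ≡⟨ cong (λ s → codewordPart z ⊕ checkPart s) s≡0 ⟩
  codewordPart z ⊕ zeroW                     ≡⟨ Words.identityʳ _ ⟩
  codewordPart z                             ∎)
  where open ≡-Reasoning

δ : Word → Word → Syndrome
δ u v = syndrome u +ₛ syndrome v

sameCoset⇒syndrome≡ : ∀ {x y} → SameCoset x y → syndrome x ≡ syndrome y
sameCoset⇒syndrome≡ {x} {y} x+y∈D =
  Syndromes.∙≡ε⇒≡ (trans (sym (syndrome-additive x y)) (InD⇒syndrome≡0 x+y∈D))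

syndrome≡⇒sameCoset : ∀ {x y} → syndrome x ≡ syndrome y → SameCoset x y
syndrome≡⇒sameCoset {x} {y} p = syndrome≡0⇒InD (begin
  syndrome (x ⊕ y)              ≡⟨ syndrome-additive x y ⟩
  syndrome x +ₛ syndrome y      ≡⟨ cong (_+ₛ syndrome y) p ⟩
  syndrome y +ₛ syndrome y      ≡⟨ Syndromes.self-inverse (syndrome y) ⟩
  0ₛ                            ∎)
  where open ≡-Reasoning

adj⇒step : ∀ {x y} → Adj x y → Σ Word λ e → e ∈ units n × syndrome x ≡ syndrome y +ₛ syndrome e
adj⇒step {x} {y} (e , wt≡1 , x+y+e∈D) = e , wt≡1⇒∈units e wt≡1 , Syndromes.∙≡ε⇒≡ (begin
  syndrome x +ₛ (syndrome y +ₛ syndrome e)  ≡⟨ sym (Syndromes.assoc _ _ _) ⟩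
  syndrome x +ₛ syndrome y +ₛ syndrome e    ≡⟨ cong (_+ₛ syndrome e) (sym (syndrome-additive x y)) ⟩
  syndrome (x ⊕ y) +ₛ syndrome e            ≡⟨ sym (syndrome-additive (x ⊕ y) e) ⟩
  syndrome (x ⊕ y ⊕ e)                      ≡⟨ InD⇒syndrome≡0 x+y+e∈D ⟩
  0ₛ                                        ∎)
  where open ≡-Reasoning

adj-⊕unit : ∀ x {e} → e ∈ units n → Adj x (x ⊕ e)
adj-⊕unit x {e} e∈units =
  e , ∈units⇒wt≡1 e∈units , subst InD (sym x+[x+e]+e≡0) (replicate 12 false , refl)
  where
  x+[x+e]+e≡0 : x ⊕ (x ⊕ e) ⊕ e ≡ zeroW
  x+[x+e]+e≡0 = trans (cong (_⊕ e) (Words.cancelˡ x e)) (Words.self-inverse e)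

δ-stepˡ : ∀ x y v e → syndrome x ≡ syndrome y +ₛ syndrome e → δ x v ≡ δ y v +ₛ syndrome e
δ-stepˡ x y v e p =
  trans (cong (_+ₛ syndrome v) p) (Syndromes.xy∙z≡xz∙y (syndrome y) (syndrome e) (syndrome v))

δ-stepʳ : ∀ u x y e → syndrome x ≡ syndrome y +ₛ syndrome e → δ u x ≡ δ u y +ₛ syndrome e
δ-stepʳ u x y e p = trans (cong (syndrome u +ₛ_) p) (sym (Syndromes.assoc _ _ _))

units-syndromes-distinct : AllPairs (λ e e′ → ¬ syndrome e ≡ syndrome e′) (units n)
units-syndromes-distinct = from-yes (allPairs? (λ e e′ → ¬? (syndrome e ≟ₛ syndrome e′)) (units n))

connection : List Syndrome
connection = map syndrome (units n)

-- The connection list is a parameter, not the constant `connection`, so that deciding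
-- these predicates for every syndrome evaluates it only once.
module CayleyChecks (d : Syndrome → ℕ) (L : List Syndrome) where

  step? : Decidable (λ s → All (λ x → d (s +ₛ x) ≤ suc (d s)) L)
  step? s = All.all? (λ x → d (s +ₛ x) ≤? suc (d s)) L

  descent? : Decidable (λ s → s ≡ 0ₛ ⊎ Any (λ x → suc (d (s +ₛ x)) ≡ d s) L)
  descent? s = (s ≟ₛ 0ₛ) ⊎-dec any? (λ x → suc (d (s +ₛ x)) ≟ℕ d s) L

  neighboursAt : Syndrome → ℕ → ℕ
  neighboursAt s t = length (filter (λ x → d (s +ₛ x) ≟ℕ t) L)

  HasArray : ∀ {k} → Vec ℕ k → Vec ℕ k → Syndrome → Set
  HasArray bs cs s =
      (∀ i → d s ≡ toℕ i → neighboursAt s (suc (toℕ i)) ≡ lookup bs i)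
    × (∀ i → d s ≡ suc (toℕ i) → neighboursAt s (toℕ i) ≡ lookup cs i)

  hasArray? : ∀ {k} (bs cs : Vec ℕ k) → Decidable (HasArray bs cs)
  hasArray? bs cs s =
        Fin.all? (λ i → (d s ≟ℕ toℕ i) →-dec (neighboursAt s (suc (toℕ i)) ≟ℕ lookup bs i))
    ×-dec Fin.all? (λ i → (d s ≟ℕ suc (toℕ i)) →-dec (neighboursAt s (toℕ i) ≟ℕ lookup cs i))

module DistanceCertificate
  (d : Syndrome → ℕ)
  (d-0ₛ : d 0ₛ ≡ 0)
  (d-step : ∀ s → All (λ x → d (s +ₛ x) ≤ suc (d s)) connection)
  (d-descent : ∀ s → s ≡ 0ₛ ⊎ Any (λ x → suc (d (s +ₛ x)) ≡ d s) connection)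
  where

  open CayleyChecks d connection using (neighboursAt; HasArray)

  walk⇒d≤ : ∀ j u v → Walk j u v → d (δ u v) ≤ j
  walk⇒d≤ zero u v u~v = ≤-reflexive (trans (cong d δ≡0) d-0ₛ)
    where
    δ≡0 : δ u v ≡ 0ₛ
    δ≡0 = trans (cong (_+ₛ syndrome v) (sameCoset⇒syndrome≡ u~v)) (Syndromes.self-inverse (syndrome v))
  walk⇒d≤ (suc j) u v (w , u~w , w⇝v) with adj⇒step u~w
  ... | e , e∈units , σu≡σw+σe = begin
    d (δ u v)                 ≡⟨ cong d (δ-stepˡ u w v e σu≡σw+σe) ⟩
    d (δ w v +ₛ syndrome e)   ≤⟨ All.lookup (d-step (δ w v)) (∈-map⁺ syndrome e∈units) ⟩
    suc (d (δ w v))           ≤⟨ s≤s (walk⇒d≤ j w v w⇝v) ⟩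
    suc j                     ∎
    where open ≤-Reasoning

  d≡0⇒≡0ₛ : ∀ {s} → d s ≡ 0 → s ≡ 0ₛ
  d≡0⇒≡0ₛ {s} d≡0 with d-descent s
  ... | inj₁ s≡0     = s≡0
  ... | inj₂ descends = ⊥-elim (1+n≢0 (trans (proj₂ (proj₂ (find descends))) d≡0))

  descend : ∀ {s k} → d s ≡ suc k → Σ Word λ e → e ∈ units n × d (s +ₛ syndrome e) ≡ k
  descend {s} d≡1+k with d-descent s
  ... | inj₁ refl     = ⊥-elim (0≢1+n (trans (sym d-0ₛ) d≡1+k))
  ... | inj₂ descends with find descends
  ...   | x , x∈connection , closer with ∈-map⁻ syndrome x∈connection
  ...     | e , e∈units , refl = e , e∈units , suc-injective (trans closer d≡1+k)

  d≡⇒walk : ∀ k u v → d (δ u v) ≡ k → Walk k u v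
  d≡⇒walk zero    u v d≡0   = syndrome≡⇒sameCoset (Syndromes.∙≡ε⇒≡ (d≡0⇒≡0ₛ d≡0))
  d≡⇒walk (suc k) u v d≡1+k with descend d≡1+k
  ... | e , e∈units , d≡k = u ⊕ e , adj-⊕unit u e∈units , d≡⇒walk k (u ⊕ e) v (trans (cong d δ-shift) d≡k)
    where
    δ-shift : δ (u ⊕ e) v ≡ δ u v +ₛ syndrome e
    δ-shift = δ-stepˡ (u ⊕ e) u v e (syndrome-additive u e)

  dist⇒d≡ : ∀ {u v i} → Dist u v i → d (δ u v) ≡ i
  dist⇒d≡ {u} {v} {i} (u⇝v , minimal) with m≤n⇒m<n∨m≡n (walk⇒d≤ i u v u⇝v)
  ... | inj₁ d<i = ⊥-elim (minimal (d (δ u v)) d<i (d≡⇒walk _ u v refl))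
  ... | inj₂ d≡i = d≡i

  d≡⇒dist : ∀ {u v i} → d (δ u v) ≡ i → Dist u v i
  d≡⇒dist {u} {v} {i} d≡i = d≡⇒walk i u v d≡i , λ j j<i u⇝v → <⇒≱ j<i (subst (_≤ j) d≡i (walk⇒d≤ j u v u⇝v))

  neighbourCount : ∀ u v t → CosetCount (λ w → Adj v w × Dist u w t) (neighboursAt (δ u v) t)
  neighbourCount u v t = map (v ⊕_) closer , neighbours-length , members , distinct , complete
    where
    lands? : Decidable (λ x → d (δ u v +ₛ x) ≡ t)
    lands? x = d (δ u v +ₛ x) ≟ℕ t

    closer : List Word
    closer = filter (lands? ∘ syndrome) (units n)

    neighbours-length : length (map (v ⊕_) closer) ≡ neighboursAt (δ u v) t
    neighbours-length = trans (length-map (v ⊕_) closer) (sym (length-filter-map lands? syndrome (units n)))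

    δ-⊕unit : ∀ e → δ u (v ⊕ e) ≡ δ u v +ₛ syndrome e
    δ-⊕unit e = δ-stepʳ u (v ⊕ e) v e (syndrome-additive v e)

    members : All (λ w → Adj v w × Dist u w t) (map (v ⊕_) closer)
    members = map⁺ (All.tabulate λ {e} e∈closer →
      let e∈units , lands = ∈-filter⁻ (lands? ∘ syndrome) e∈closer
      in adj-⊕unit v e∈units , d≡⇒dist (trans (cong d (δ-⊕unit e)) lands))

    distinct : AllPairs (λ a b → ¬ SameCoset a b) (map (v ⊕_) closer)
    distinct = AllPairsₚ.map⁺ (AllPairsₚ.filter⁺ (lands? ∘ syndrome) (AllPairs.map
      (λ {e} {e′} σe≢σe′ v+e~v+e′ → σe≢σe′ (Syndromes.∙-cancelˡ (syndrome v) (begin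
        syndrome v +ₛ syndrome e    ≡⟨ sym (syndrome-additive v e) ⟩
        syndrome (v ⊕ e)            ≡⟨ sameCoset⇒syndrome≡ v+e~v+e′ ⟩
        syndrome (v ⊕ e′)           ≡⟨ syndrome-additive v e′ ⟩
        syndrome v +ₛ syndrome e′   ∎)))
      units-syndromes-distinct))
      where open ≡-Reasoning

    complete : ∀ w → Adj v w × Dist u w t → Any (SameCoset w) (map (v ⊕_) closer)
    complete w (v~w , u-w) with adj⇒step v~w
    ... | e , e∈units , σv≡σw+σe = lose (∈-map⁺ (v ⊕_) (∈-filter⁺ (lands? ∘ syndrome) e∈units lands))
                                       (syndrome≡⇒sameCoset (trans σw≡σv+σe (sym (syndrome-additive v e))))
      where
      σw≡σv+σe : syndrome w ≡ syndrome v +ₛ syndrome e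
      σw≡σv+σe = Syndromes.x≡y∙z⇒y≡x∙z σv≡σw+σe
      lands : d (δ u v +ₛ syndrome e) ≡ t
      lands = trans (cong d (sym (δ-stepʳ u w v e σw≡σv+σe))) (dist⇒d≡ u-w)

  isDRGWithArray : ∀ k (bs cs : Vec ℕ k) → (∀ s → d s ≤ k) → (∀ s → HasArray bs cs s) →
                   IsDRGWithArray k bs cs
  isDRGWithArray k bs cs d≤k array = diameter , bᵢ , cᵢ
    where
    diameter : ∀ u v → Σ ℕ (λ j → j ≤ k × Walk j u v)
    diameter u v = d (δ u v) , d≤k (δ u v) , d≡⇒walk _ u v refl

    bᵢ : ∀ i u v → Dist u v (toℕ i) → CosetCount (λ w → Adj v w × Dist u w (suc (toℕ i))) (lookup bs i)
    bᵢ i u v u-v = subst (CosetCount _) (proj₁ (array (δ u v)) i (dist⇒d≡ u-v)) (neighbourCount u v _)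

    cᵢ : ∀ i u v → Dist u v (suc (toℕ i)) → CosetCount (λ w → Adj v w × Dist u w (toℕ i)) (lookup cs i)
    cᵢ i u v u-v = subst (CosetCount _) (proj₂ (array (δ u v)) i (dist⇒d≡ u-v)) (neighbourCount u v _)

Table : ℕ → Set
Table zero    = ℕ
Table (suc m) = Vec (Table m) 4

lookupTable : ∀ {m} → Table m → Vec F4 m → ℕ
lookupTable {zero}  t []      = t
lookupTable {suc m} t (a ∷ v) = lookupTable (lookup t (index a)) v

-- Distances from 0ₛ in the Cayley graph, found by breadth-first search outside Agda;
-- they are trusted only through the checks below.
distanceTable : Table 5
distanceTable =
  ( ( ( ((0 ∷ 1 ∷ 1 ∷ 1 ∷ []) ∷ (1 ∷ 2 ∷ 2 ∷ 2 ∷ []) ∷ (1 ∷ 2 ∷ 2 ∷ 2 ∷ []) ∷ (1 ∷ 2 ∷ 2 ∷ 2 ∷ []) ∷ [])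
          ∷ ((1 ∷ 2 ∷ 2 ∷ 2 ∷ []) ∷ (2 ∷ 2 ∷ 3 ∷ 3 ∷ []) ∷ (2 ∷ 2 ∷ 3 ∷ 3 ∷ []) ∷ (2 ∷ 3 ∷ 2 ∷ 2 ∷ []) ∷ [])
          ∷ ((1 ∷ 2 ∷ 2 ∷ 2 ∷ []) ∷ (2 ∷ 3 ∷ 2 ∷ 3 ∷ []) ∷ (2 ∷ 2 ∷ 3 ∷ 2 ∷ []) ∷ (2 ∷ 3 ∷ 3 ∷ 2 ∷ []) ∷ [])
          ∷ ((1 ∷ 2 ∷ 2 ∷ 2 ∷ []) ∷ (2 ∷ 2 ∷ 2 ∷ 3 ∷ []) ∷ (2 ∷ 3 ∷ 3 ∷ 2 ∷ []) ∷ (2 ∷ 3 ∷ 2 ∷ 3 ∷ []) ∷ [])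
          ∷ [])
      ∷ ( ((1 ∷ 2 ∷ 2 ∷ 2 ∷ []) ∷ (2 ∷ 2 ∷ 2 ∷ 3 ∷ []) ∷ (2 ∷ 3 ∷ 2 ∷ 2 ∷ []) ∷ (2 ∷ 3 ∷ 3 ∷ 3 ∷ []) ∷ [])
          ∷ ((2 ∷ 3 ∷ 3 ∷ 2 ∷ []) ∷ (2 ∷ 3 ∷ 3 ∷ 3 ∷ []) ∷ (3 ∷ 3 ∷ 3 ∷ 2 ∷ []) ∷ (2 ∷ 3 ∷ 3 ∷ 2 ∷ []) ∷ [])
          ∷ ((2 ∷ 3 ∷ 2 ∷ 2 ∷ []) ∷ (3 ∷ 3 ∷ 3 ∷ 3 ∷ []) ∷ (3 ∷ 2 ∷ 2 ∷ 2 ∷ []) ∷ (3 ∷ 3 ∷ 3 ∷ 3 ∷ []) ∷ [])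
          ∷ ((2 ∷ 3 ∷ 3 ∷ 2 ∷ []) ∷ (3 ∷ 2 ∷ 3 ∷ 2 ∷ []) ∷ (2 ∷ 2 ∷ 2 ∷ 1 ∷ []) ∷ (2 ∷ 2 ∷ 3 ∷ 2 ∷ []) ∷ [])
          ∷ [])
      ∷ ( ((1 ∷ 2 ∷ 2 ∷ 2 ∷ []) ∷ (2 ∷ 3 ∷ 3 ∷ 3 ∷ []) ∷ (2 ∷ 2 ∷ 3 ∷ 3 ∷ []) ∷ (2 ∷ 2 ∷ 2 ∷ 2 ∷ []) ∷ [])
          ∷ ((2 ∷ 2 ∷ 2 ∷ 3 ∷ []) ∷ (3 ∷ 3 ∷ 3 ∷ 3 ∷ []) ∷ (2 ∷ 2 ∷ 2 ∷ 3 ∷ []) ∷ (3 ∷ 3 ∷ 3 ∷ 3 ∷ []) ∷ [])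
          ∷ ((2 ∷ 2 ∷ 3 ∷ 3 ∷ []) ∷ (2 ∷ 2 ∷ 2 ∷ 3 ∷ []) ∷ (2 ∷ 1 ∷ 2 ∷ 2 ∷ []) ∷ (2 ∷ 2 ∷ 3 ∷ 3 ∷ []) ∷ [])
          ∷ ((2 ∷ 3 ∷ 3 ∷ 2 ∷ []) ∷ (3 ∷ 2 ∷ 3 ∷ 2 ∷ []) ∷ (3 ∷ 2 ∷ 3 ∷ 2 ∷ []) ∷ (3 ∷ 3 ∷ 3 ∷ 3 ∷ []) ∷ [])
          ∷ [])
      ∷ ( ((1 ∷ 2 ∷ 2 ∷ 2 ∷ []) ∷ (2 ∷ 2 ∷ 3 ∷ 2 ∷ []) ∷ (2 ∷ 3 ∷ 3 ∷ 2 ∷ []) ∷ (2 ∷ 3 ∷ 2 ∷ 3 ∷ []) ∷ [])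
          ∷ ((2 ∷ 3 ∷ 2 ∷ 3 ∷ []) ∷ (2 ∷ 2 ∷ 3 ∷ 2 ∷ []) ∷ (3 ∷ 3 ∷ 3 ∷ 3 ∷ []) ∷ (3 ∷ 3 ∷ 2 ∷ 3 ∷ []) ∷ [])
          ∷ ((2 ∷ 2 ∷ 3 ∷ 3 ∷ []) ∷ (3 ∷ 2 ∷ 3 ∷ 3 ∷ []) ∷ (3 ∷ 2 ∷ 3 ∷ 3 ∷ []) ∷ (2 ∷ 2 ∷ 3 ∷ 3 ∷ []) ∷ [])
          ∷ ((2 ∷ 2 ∷ 2 ∷ 3 ∷ []) ∷ (2 ∷ 1 ∷ 2 ∷ 2 ∷ []) ∷ (2 ∷ 2 ∷ 3 ∷ 2 ∷ []) ∷ (3 ∷ 2 ∷ 3 ∷ 3 ∷ []) ∷ [])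
          ∷ [])
      ∷ [])
  ∷ ( ( ((1 ∷ 2 ∷ 2 ∷ 2 ∷ []) ∷ (2 ∷ 2 ∷ 2 ∷ 3 ∷ []) ∷ (2 ∷ 2 ∷ 2 ∷ 3 ∷ []) ∷ (2 ∷ 3 ∷ 3 ∷ 3 ∷ []) ∷ [])
          ∷ ((2 ∷ 2 ∷ 3 ∷ 3 ∷ []) ∷ (2 ∷ 1 ∷ 2 ∷ 2 ∷ []) ∷ (2 ∷ 2 ∷ 2 ∷ 3 ∷ []) ∷ (3 ∷ 2 ∷ 3 ∷ 2 ∷ []) ∷ [])
          ∷ ((2 ∷ 3 ∷ 3 ∷ 2 ∷ []) ∷ (2 ∷ 2 ∷ 2 ∷ 3 ∷ []) ∷ (3 ∷ 3 ∷ 3 ∷ 3 ∷ []) ∷ (3 ∷ 3 ∷ 3 ∷ 2 ∷ []) ∷ [])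
          ∷ ((2 ∷ 2 ∷ 3 ∷ 2 ∷ []) ∷ (3 ∷ 2 ∷ 3 ∷ 3 ∷ []) ∷ (3 ∷ 3 ∷ 3 ∷ 3 ∷ []) ∷ (2 ∷ 2 ∷ 3 ∷ 3 ∷ []) ∷ [])
          ∷ [])
      ∷ ( ((2 ∷ 2 ∷ 2 ∷ 3 ∷ []) ∷ (2 ∷ 2 ∷ 1 ∷ 2 ∷ []) ∷ (3 ∷ 3 ∷ 2 ∷ 3 ∷ []) ∷ (2 ∷ 3 ∷ 2 ∷ 2 ∷ []) ∷ [])
          ∷ ((3 ∷ 3 ∷ 3 ∷ 2 ∷ []) ∷ (2 ∷ 2 ∷ 2 ∷ 2 ∷ []) ∷ (2 ∷ 3 ∷ 3 ∷ 2 ∷ []) ∷ (2 ∷ 2 ∷ 2 ∷ 1 ∷ []) ∷ [])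
          ∷ ((3 ∷ 3 ∷ 3 ∷ 3 ∷ []) ∷ (3 ∷ 3 ∷ 2 ∷ 3 ∷ []) ∷ (3 ∷ 2 ∷ 2 ∷ 3 ∷ []) ∷ (3 ∷ 2 ∷ 2 ∷ 2 ∷ []) ∷ [])
          ∷ ((3 ∷ 3 ∷ 2 ∷ 2 ∷ []) ∷ (3 ∷ 3 ∷ 2 ∷ 2 ∷ []) ∷ (3 ∷ 3 ∷ 3 ∷ 2 ∷ []) ∷ (3 ∷ 3 ∷ 3 ∷ 2 ∷ []) ∷ [])
          ∷ [])
      ∷ ( ((2 ∷ 3 ∷ 3 ∷ 2 ∷ []) ∷ (3 ∷ 3 ∷ 2 ∷ 2 ∷ []) ∷ (2 ∷ 3 ∷ 3 ∷ 3 ∷ []) ∷ (3 ∷ 3 ∷ 3 ∷ 2 ∷ []) ∷ [])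
          ∷ ((2 ∷ 2 ∷ 3 ∷ 2 ∷ []) ∷ (2 ∷ 2 ∷ 3 ∷ 3 ∷ []) ∷ (1 ∷ 2 ∷ 2 ∷ 2 ∷ []) ∷ (2 ∷ 3 ∷ 3 ∷ 2 ∷ []) ∷ [])
          ∷ ((2 ∷ 3 ∷ 3 ∷ 2 ∷ []) ∷ (3 ∷ 3 ∷ 2 ∷ 3 ∷ []) ∷ (2 ∷ 2 ∷ 2 ∷ 3 ∷ []) ∷ (3 ∷ 3 ∷ 3 ∷ 3 ∷ []) ∷ [])
          ∷ ((2 ∷ 2 ∷ 2 ∷ 1 ∷ []) ∷ (3 ∷ 3 ∷ 3 ∷ 2 ∷ []) ∷ (2 ∷ 2 ∷ 3 ∷ 2 ∷ []) ∷ (2 ∷ 3 ∷ 2 ∷ 2 ∷ []) ∷ [])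
          ∷ [])
      ∷ ( ((2 ∷ 3 ∷ 2 ∷ 3 ∷ []) ∷ (3 ∷ 2 ∷ 2 ∷ 3 ∷ []) ∷ (2 ∷ 3 ∷ 3 ∷ 3 ∷ []) ∷ (3 ∷ 3 ∷ 2 ∷ 3 ∷ []) ∷ [])
          ∷ ((3 ∷ 3 ∷ 3 ∷ 3 ∷ []) ∷ (3 ∷ 2 ∷ 3 ∷ 3 ∷ []) ∷ (2 ∷ 3 ∷ 3 ∷ 2 ∷ []) ∷ (3 ∷ 2 ∷ 2 ∷ 2 ∷ []) ∷ [])
          ∷ ((2 ∷ 3 ∷ 3 ∷ 2 ∷ []) ∷ (3 ∷ 2 ∷ 3 ∷ 3 ∷ []) ∷ (2 ∷ 3 ∷ 3 ∷ 3 ∷ []) ∷ (3 ∷ 2 ∷ 3 ∷ 2 ∷ []) ∷ [])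
          ∷ ((3 ∷ 3 ∷ 2 ∷ 2 ∷ []) ∷ (3 ∷ 2 ∷ 2 ∷ 3 ∷ []) ∷ (2 ∷ 3 ∷ 3 ∷ 2 ∷ []) ∷ (3 ∷ 3 ∷ 3 ∷ 3 ∷ []) ∷ [])
          ∷ [])
      ∷ [])
  ∷ ( ( ((1 ∷ 2 ∷ 2 ∷ 2 ∷ []) ∷ (2 ∷ 3 ∷ 3 ∷ 3 ∷ []) ∷ (2 ∷ 2 ∷ 3 ∷ 3 ∷ []) ∷ (2 ∷ 2 ∷ 2 ∷ 2 ∷ []) ∷ [])
          ∷ ((2 ∷ 2 ∷ 3 ∷ 3 ∷ []) ∷ (2 ∷ 2 ∷ 3 ∷ 2 ∷ []) ∷ (3 ∷ 3 ∷ 3 ∷ 3 ∷ []) ∷ (3 ∷ 3 ∷ 3 ∷ 2 ∷ []) ∷ [])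
          ∷ ((2 ∷ 3 ∷ 2 ∷ 2 ∷ []) ∷ (3 ∷ 3 ∷ 2 ∷ 2 ∷ []) ∷ (3 ∷ 3 ∷ 2 ∷ 2 ∷ []) ∷ (2 ∷ 2 ∷ 2 ∷ 1 ∷ []) ∷ [])
          ∷ ((2 ∷ 3 ∷ 3 ∷ 2 ∷ []) ∷ (3 ∷ 3 ∷ 3 ∷ 3 ∷ []) ∷ (2 ∷ 3 ∷ 3 ∷ 2 ∷ []) ∷ (2 ∷ 3 ∷ 3 ∷ 2 ∷ []) ∷ [])
          ∷ [])
      ∷ ( ((2 ∷ 2 ∷ 3 ∷ 3 ∷ []) ∷ (2 ∷ 3 ∷ 2 ∷ 3 ∷ []) ∷ (3 ∷ 3 ∷ 2 ∷ 3 ∷ []) ∷ (3 ∷ 3 ∷ 2 ∷ 3 ∷ []) ∷ [])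
          ∷ ((2 ∷ 2 ∷ 3 ∷ 3 ∷ []) ∷ (1 ∷ 2 ∷ 2 ∷ 2 ∷ []) ∷ (2 ∷ 3 ∷ 2 ∷ 3 ∷ []) ∷ (2 ∷ 3 ∷ 2 ∷ 2 ∷ []) ∷ [])
          ∷ ((2 ∷ 3 ∷ 2 ∷ 3 ∷ []) ∷ (2 ∷ 3 ∷ 2 ∷ 2 ∷ []) ∷ (2 ∷ 2 ∷ 1 ∷ 2 ∷ []) ∷ (3 ∷ 3 ∷ 2 ∷ 2 ∷ []) ∷ [])
          ∷ ((3 ∷ 3 ∷ 3 ∷ 3 ∷ []) ∷ (2 ∷ 2 ∷ 3 ∷ 3 ∷ []) ∷ (2 ∷ 2 ∷ 2 ∷ 2 ∷ []) ∷ (3 ∷ 3 ∷ 3 ∷ 3 ∷ []) ∷ [])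
          ∷ [])
      ∷ ( ((2 ∷ 3 ∷ 3 ∷ 2 ∷ []) ∷ (2 ∷ 3 ∷ 2 ∷ 3 ∷ []) ∷ (3 ∷ 3 ∷ 3 ∷ 3 ∷ []) ∷ (3 ∷ 3 ∷ 2 ∷ 2 ∷ []) ∷ [])
          ∷ ((3 ∷ 2 ∷ 3 ∷ 3 ∷ []) ∷ (2 ∷ 2 ∷ 3 ∷ 3 ∷ []) ∷ (2 ∷ 3 ∷ 2 ∷ 3 ∷ []) ∷ (3 ∷ 3 ∷ 3 ∷ 2 ∷ []) ∷ [])
          ∷ ((3 ∷ 2 ∷ 3 ∷ 3 ∷ []) ∷ (3 ∷ 3 ∷ 3 ∷ 3 ∷ []) ∷ (3 ∷ 2 ∷ 2 ∷ 2 ∷ []) ∷ (3 ∷ 2 ∷ 3 ∷ 2 ∷ []) ∷ [])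
          ∷ ((3 ∷ 3 ∷ 2 ∷ 2 ∷ []) ∷ (2 ∷ 2 ∷ 3 ∷ 3 ∷ []) ∷ (2 ∷ 3 ∷ 3 ∷ 3 ∷ []) ∷ (3 ∷ 3 ∷ 2 ∷ 3 ∷ []) ∷ [])
          ∷ [])
      ∷ ( ((2 ∷ 3 ∷ 2 ∷ 2 ∷ []) ∷ (3 ∷ 3 ∷ 2 ∷ 3 ∷ []) ∷ (2 ∷ 2 ∷ 2 ∷ 3 ∷ []) ∷ (2 ∷ 2 ∷ 1 ∷ 2 ∷ []) ∷ [])
          ∷ ((2 ∷ 3 ∷ 3 ∷ 3 ∷ []) ∷ (2 ∷ 3 ∷ 3 ∷ 2 ∷ []) ∷ (2 ∷ 3 ∷ 2 ∷ 3 ∷ []) ∷ (3 ∷ 3 ∷ 2 ∷ 3 ∷ []) ∷ [])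
          ∷ ((3 ∷ 3 ∷ 3 ∷ 3 ∷ []) ∷ (3 ∷ 3 ∷ 3 ∷ 2 ∷ []) ∷ (2 ∷ 3 ∷ 2 ∷ 3 ∷ []) ∷ (3 ∷ 2 ∷ 2 ∷ 2 ∷ []) ∷ [])
          ∷ ((2 ∷ 3 ∷ 2 ∷ 3 ∷ []) ∷ (2 ∷ 2 ∷ 3 ∷ 3 ∷ []) ∷ (1 ∷ 2 ∷ 2 ∷ 2 ∷ []) ∷ (2 ∷ 2 ∷ 2 ∷ 3 ∷ []) ∷ [])
          ∷ [])
      ∷ [])
  ∷ ( ( ((1 ∷ 2 ∷ 2 ∷ 2 ∷ []) ∷ (2 ∷ 3 ∷ 2 ∷ 2 ∷ []) ∷ (2 ∷ 3 ∷ 3 ∷ 2 ∷ []) ∷ (2 ∷ 3 ∷ 3 ∷ 2 ∷ []) ∷ [])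
          ∷ ((2 ∷ 2 ∷ 2 ∷ 3 ∷ []) ∷ (3 ∷ 2 ∷ 2 ∷ 3 ∷ []) ∷ (2 ∷ 3 ∷ 3 ∷ 3 ∷ []) ∷ (3 ∷ 3 ∷ 3 ∷ 3 ∷ []) ∷ [])
          ∷ ((2 ∷ 3 ∷ 2 ∷ 3 ∷ []) ∷ (2 ∷ 2 ∷ 1 ∷ 2 ∷ []) ∷ (3 ∷ 3 ∷ 2 ∷ 3 ∷ []) ∷ (2 ∷ 2 ∷ 2 ∷ 2 ∷ []) ∷ [])
          ∷ ((2 ∷ 3 ∷ 2 ∷ 3 ∷ []) ∷ (3 ∷ 2 ∷ 2 ∷ 3 ∷ []) ∷ (2 ∷ 3 ∷ 2 ∷ 3 ∷ []) ∷ (3 ∷ 3 ∷ 3 ∷ 3 ∷ []) ∷ [])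
          ∷ [])
      ∷ ( ((2 ∷ 2 ∷ 3 ∷ 3 ∷ []) ∷ (2 ∷ 3 ∷ 2 ∷ 3 ∷ []) ∷ (3 ∷ 3 ∷ 3 ∷ 2 ∷ []) ∷ (3 ∷ 3 ∷ 3 ∷ 2 ∷ []) ∷ [])
          ∷ ((3 ∷ 2 ∷ 3 ∷ 3 ∷ []) ∷ (2 ∷ 3 ∷ 2 ∷ 3 ∷ []) ∷ (3 ∷ 3 ∷ 3 ∷ 2 ∷ []) ∷ (3 ∷ 2 ∷ 3 ∷ 2 ∷ []) ∷ [])
          ∷ ((2 ∷ 3 ∷ 3 ∷ 3 ∷ []) ∷ (2 ∷ 3 ∷ 2 ∷ 3 ∷ []) ∷ (3 ∷ 2 ∷ 2 ∷ 3 ∷ []) ∷ (3 ∷ 2 ∷ 3 ∷ 3 ∷ []) ∷ [])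
          ∷ ((2 ∷ 3 ∷ 2 ∷ 3 ∷ []) ∷ (3 ∷ 3 ∷ 3 ∷ 3 ∷ []) ∷ (3 ∷ 3 ∷ 2 ∷ 2 ∷ []) ∷ (3 ∷ 2 ∷ 3 ∷ 2 ∷ []) ∷ [])
          ∷ [])
      ∷ ( ((2 ∷ 2 ∷ 3 ∷ 2 ∷ []) ∷ (3 ∷ 3 ∷ 3 ∷ 2 ∷ []) ∷ (2 ∷ 2 ∷ 3 ∷ 2 ∷ []) ∷ (2 ∷ 2 ∷ 2 ∷ 1 ∷ []) ∷ [])
          ∷ ((2 ∷ 1 ∷ 2 ∷ 2 ∷ []) ∷ (3 ∷ 2 ∷ 2 ∷ 3 ∷ []) ∷ (2 ∷ 2 ∷ 3 ∷ 3 ∷ []) ∷ (2 ∷ 2 ∷ 3 ∷ 2 ∷ []) ∷ [])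
          ∷ ((3 ∷ 2 ∷ 3 ∷ 3 ∷ []) ∷ (3 ∷ 3 ∷ 2 ∷ 2 ∷ []) ∷ (3 ∷ 2 ∷ 3 ∷ 3 ∷ []) ∷ (3 ∷ 2 ∷ 3 ∷ 2 ∷ []) ∷ [])
          ∷ ((3 ∷ 2 ∷ 2 ∷ 2 ∷ []) ∷ (3 ∷ 3 ∷ 3 ∷ 2 ∷ []) ∷ (3 ∷ 3 ∷ 3 ∷ 3 ∷ []) ∷ (3 ∷ 3 ∷ 2 ∷ 2 ∷ []) ∷ [])
          ∷ [])
      ∷ ( ((2 ∷ 3 ∷ 2 ∷ 3 ∷ []) ∷ (3 ∷ 3 ∷ 3 ∷ 3 ∷ []) ∷ (3 ∷ 3 ∷ 3 ∷ 3 ∷ []) ∷ (2 ∷ 2 ∷ 2 ∷ 2 ∷ []) ∷ [])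
          ∷ ((3 ∷ 2 ∷ 2 ∷ 2 ∷ []) ∷ (3 ∷ 3 ∷ 3 ∷ 3 ∷ []) ∷ (3 ∷ 2 ∷ 3 ∷ 2 ∷ []) ∷ (3 ∷ 2 ∷ 3 ∷ 3 ∷ []) ∷ [])
          ∷ ((3 ∷ 2 ∷ 2 ∷ 3 ∷ []) ∷ (3 ∷ 2 ∷ 2 ∷ 2 ∷ []) ∷ (3 ∷ 2 ∷ 2 ∷ 3 ∷ []) ∷ (2 ∷ 1 ∷ 2 ∷ 2 ∷ []) ∷ [])
          ∷ ((2 ∷ 2 ∷ 1 ∷ 2 ∷ []) ∷ (2 ∷ 2 ∷ 2 ∷ 3 ∷ []) ∷ (2 ∷ 3 ∷ 2 ∷ 3 ∷ []) ∷ (3 ∷ 2 ∷ 2 ∷ 3 ∷ []) ∷ [])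
          ∷ [])
      ∷ [])
  ∷ [])

distance : Syndrome → ℕ
distance = lookupTable distanceTable

open CayleyChecks distance connection using (step?; descent?; hasArray?)
open DistanceCertificate distance refl
  (from-yes (∀F4ⁿ? 5 step?)) (from-yes (∀F4ⁿ? 5 descent?))

theorem8 : IsDRGWithArray 3 (33 ∷ 30 ∷ 15 ∷ []) (1 ∷ 2 ∷ 15 ∷ [])
theorem8 = isDRGWithArray 3 bs cs
  (from-yes (∀F4ⁿ? 5 λ s → distance s ≤? 3))
  (from-yes (∀F4ⁿ? 5 (hasArray? bs cs)))
  where
  bs cs : Vec ℕ 3
  bs = 33 ∷ 30 ∷ 15 ∷ []
  cs = 1 ∷ 2 ∷ 15 ∷ []
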